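{- Let $\Lambda$ be a self-conjugate $7$-core partition with $s$ positive parts, and let its $7$-abacus be $(0,a,b,c,d,e,f)$, so that $s=a+b+c+d+e+f$. Suppose $s\not\equiv 4\pmod 7$ and let $r\geq 0$ be an integer. (1) If $s=7r$, then $f=2r$, $a+e=2r$, $b+d=2r$, $c=r$. (2) If $s=7r+1$, then $a=2r+1$, $b+f=2r$, $c+e=2r$, $d=r$. (3) If $s=7r+2$, then $a+b=2r+1$, $c=2r+1$, $d+f=2r$, $e=r$. (4) If $s=7r+3$, then $b+c=2r+1$, $a+d=2r+1$, $e=2r+1$, $f=r$. (5) If $s=7r+5$, then $d+e=2r+1$, $c+f=2r+1$, $b=2r+2$, $a=r+1$. (6) If $s=7r+6$, then $e+f=2r+1$, $d=2r+2$, $a+c=2r+2$, $b=r+1$.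
   Context: A partition $\Lambda=(\lambda_1\geq\dots\geq\lambda_s>0)$ is a $7$-core if no hook length $h(j,k)=\lambda_j+\lambda'_k-j-k+1$ of a cell of its Ferrers--Young diagram ($\lambda'_k$ the conjugate parts) is divisible by $7$; it is self-conjugate if it equals its conjugate. Its structure numbers are $B_j=\lambda_j-j+s$ ($1\leq j\leq s$), distinct positive integers. Writing $B_j=7(r_j-1)+c_j$ with $0\leq c_j\leq 6$, one places a bead in row $r_j$, column $c_j$; the $7$-abacus of $\Lambda$ is the tuple $(m_0,m_1,\dots,m_6)$ where $m_c$ is the number of beads in column $c$ (for a $7$-core these beads occupy rows $1,\dots,m_c$, and $m_0=0$ since all $B_j\geq1$). -}

module Defs where

open import Data.Nat using (ℕ; zero; suc; _+_; _*_; _∸_; _≤_; _<_; _≤?_; _≟_)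
open import Data.Nat.DivMod using (_%_)
open import Data.Nat.Divisibility using (_∣_)
open import Data.List using (List; []; _∷_; length; filter; map; upTo; head)
open import Data.List.Relation.Unary.All using (All)
open import Data.List.Relation.Unary.Linked using (Linked)
open import Data.Maybe using (fromMaybe)
open import Data.Product using (_×_)
open import Relation.Binary.PropositionalEquality using (_≡_)
open import Relation.Nullary using (¬_)
open import Data.Nat using (_≥_)

IsPartition : List ℕ → Set
IsPartition Λ = Linked _≥_ Λ × All (λ x → 0 < x) Λ

-- λ_j, 1-indexed; 0 outside 1..s
part : List ℕ → ℕ → ℕ
part []       _             = 0
part (x ∷ xs) zero          = 0
part (x ∷ xs) (suc zero)    = x
part (x ∷ xs) (suc (suc j)) = part xs (suc j)

conjPart : List ℕ → ℕ → ℕ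
conjPart Λ k = length (filter (k ≤?_) Λ)

largest : List ℕ → ℕ
largest Λ = fromMaybe 0 (head Λ)

conjugate : List ℕ → List ℕ
conjugate Λ = map (λ k → conjPart Λ (suc k)) (upTo (largest Λ))

IsSelfConjugate : List ℕ → Set
IsSelfConjugate Λ = conjugate Λ ≡ Λ

hook : List ℕ → ℕ → ℕ → ℕ
hook Λ j k = part Λ j + conjPart Λ k + 1 ∸ (j + k)

IsCell : List ℕ → ℕ → ℕ → Set
IsCell Λ j k = (1 ≤ j) × (j ≤ length Λ) × (1 ≤ k) × (k ≤ part Λ j)

IsCore : ℕ → List ℕ → Set
IsCore t Λ = ∀ j k → IsCell Λ j k → ¬ (t ∣ hook Λ j k)

structNum : List ℕ → ℕ → ℕ
structNum Λ j = part Λ j + length Λ ∸ j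

abacus7 : List ℕ → ℕ → ℕ
abacus7 Λ c = length (filter (λ j → structNum Λ j % 7 ≟ c) (map suc (upTo (length Λ))))

-- For a partition with s parts and λ₁ ≤ n, the structure numbers B_j = λ_j − j + s and the
-- numbers s + i − λ'_{i+1} (0 ≤ i < n), the positions of the abacus gaps, together list
-- {0, …, s + n − 1} exactly once.  If the partition is self-conjugate then n = s and the
-- i-th gap is 2s − 1 − B_{i+1}, so the gaps of column c are the mirror images of the beads of
-- column c′ whenever c + c′ + 1 ≡ 2s (mod 7).  Hence m_c + m_{c′} is the number of x < 2s with
-- x ≡ c (mod 7), which for s = 7r + q equals 2r plus a count below 2q.
module Submission where

open import Data.Bool.Base using (T; true; false; if_then_else_)
open import Data.List.Base using (List; []; _∷_; length; filter; applyUpTo)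
open import Data.List.Properties using (filter-accept; filter-none; map-upTo; length-applyUpTo)
open import Data.List.Relation.Unary.All as All using (All; []; _∷_)
open import Data.List.Relation.Unary.Linked as Linked using (Linked)
open import Data.List.Relation.Unary.Linked.Properties using (Linked⇒All)
open import Data.Nat.Base
open import Data.Nat.DivMod
open import Data.Nat.Divisibility using (∣-refl; n∣m*n)
open import Data.Nat.Properties
open import Data.Nat.Solver using (module +-*-Solver)
open import Data.Product.Base using (_×_; _,_)
open import Function.Base using (_∘_)
open import Relation.Binary.PropositionalEquality
open import Relation.Nullary.Decidable using (does; yes; no; dec-true; dec-false)
open import Relation.Unary using (Decidable)
open import Defs

open +-*-Solver
open ≡-Reasoning

sumBelow : (ℕ → ℕ) → ℕ → ℕ
sumBelow f zero    = 0
sumBelow f (suc n) = f 0 + sumBelow (f ∘ suc) n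

sumBelow-cong : ∀ {f g} n → (∀ {i} → i < n → f i ≡ g i) → sumBelow f n ≡ sumBelow g n
sumBelow-cong zero    _  = refl
sumBelow-cong (suc n) eq = cong₂ _+_ (eq z<s) (sumBelow-cong n (eq ∘ s<s))

sumBelow-+ : ∀ f m n → sumBelow f (m + n) ≡ sumBelow f m + sumBelow (f ∘ (m +_)) n
sumBelow-+ f zero    n = refl
sumBelow-+ f (suc m) n =
  trans (cong (f 0 +_) (sumBelow-+ (f ∘ suc) m n)) (sym (+-assoc (f 0) _ _))

sumBelow-periodic : ∀ {f} n → (∀ i → f (n + i) ≡ f i) →
                    ∀ k → sumBelow f (k * n) ≡ k * sumBelow f n
sumBelow-periodic     n per zero    = refl
sumBelow-periodic {f} n per (suc k) = begin
  sumBelow f (n + k * n)                        ≡⟨ sumBelow-+ f n (k * n) ⟩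
  sumBelow f n + sumBelow (f ∘ (n +_)) (k * n)  ≡⟨ cong (sumBelow f n +_) shifted ⟩
  sumBelow f n + k * sumBelow f n               ∎
  where
  shifted : sumBelow (f ∘ (n +_)) (k * n) ≡ k * sumBelow f n
  shifted = trans (sumBelow-cong (k * n) (λ {i} _ → per i)) (sumBelow-periodic n per k)

sumBelow-zero : ∀ n → sumBelow (λ _ → 0) n ≡ 0
sumBelow-zero zero    = refl
sumBelow-zero (suc n) = sumBelow-zero n

δ : ℕ → ℕ → ℕ
δ c x = if does (x ≟ c) then 1 else 0

δ≡1 : ∀ {x c} → x ≡ c → δ c x ≡ 1
δ≡1 {x} {c} x≡c = cong (λ b → if b then 1 else 0) (dec-true (x ≟ c) x≡c)

δ≡0 : ∀ {x c} → x ≢ c → δ c x ≡ 0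
δ≡0 {x} {c} x≢c = cong (λ b → if b then 1 else 0) (dec-false (x ≟ c) x≢c)

δ-cong : ∀ {x c y c'} → (x ≡ c → y ≡ c') → (y ≡ c' → x ≡ c) → δ c x ≡ δ c' y
δ-cong {x} {c} to from with x ≟ c
... | yes x≡c = trans (δ≡1 x≡c) (sym (δ≡1 (to x≡c)))
... | no x≢c  = trans (δ≡0 x≢c) (sym (δ≡0 (x≢c ∘ from)))

sumBelow-δ : ∀ {c n} → c < n → sumBelow (δ c) n ≡ 1
sumBelow-δ {zero}  {suc n} _         = cong suc (sumBelow-zero n)
sumBelow-δ {suc c} {suc n} (s<s c<n) = sumBelow-δ c<n

length-filter-applyUpTo : ∀ {A : Set} {P : A → Set} (P? : Decidable P) f n →
  length (filter P? (applyUpTo f n)) ≡ sumBelow (λ i → if does (P? (f i)) then 1 else 0) n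
length-filter-applyUpTo P? f zero = refl
length-filter-applyUpTo P? f (suc n) with does (P? (f 0))
... | true  = cong suc (length-filter-applyUpTo P? (f ∘ suc) n)
... | false = length-filter-applyUpTo P? (f ∘ suc) n

countResidue : (n : ℕ) .{{_ : NonZero n}} → ℕ → ℕ → ℕ
countResidue n c = sumBelow (δ c ∘ (_% n))

countResidue-period : ∀ n .{{_ : NonZero n}} {c} → c < n → countResidue n c n ≡ 1
countResidue-period n c<n =
  trans (sumBelow-cong n (λ i<n → cong (δ _) (m<n⇒m%n≡m i<n))) (sumBelow-δ c<n)

countResidue-+* : ∀ n .{{_ : NonZero n}} {c} → c < n →
                  ∀ k t → countResidue n c (k * n + t) ≡ k + countResidue n c t
countResidue-+* n {c} c<n k t = begin
  countResidue n c (k * n + t)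
    ≡⟨ sumBelow-+ (δ c ∘ (_% n)) (k * n) t ⟩
  countResidue n c (k * n) + sumBelow (δ c ∘ (_% n) ∘ (k * n +_)) t
    ≡⟨ cong₂ _+_ (sumBelow-periodic n (λ i → cong (δ c) (%-remove-+ˡ i ∣-refl)) k)
                 (sumBelow-cong t (λ {i} _ → cong (δ c) (%-remove-+ˡ i (n∣m*n k)))) ⟩
  k * countResidue n c n + countResidue n c t
    ≡⟨ cong (λ m → k * m + countResidue n c t) (countResidue-period n c<n) ⟩
  k * 1 + countResidue n c t
    ≡⟨ cong (_+ countResidue n c t) (*-identityʳ k) ⟩
  k + countResidue n c t ∎

%-cancelʳ-+ : ∀ {a b} k n .{{_ : NonZero n}} → (a + k) % n ≡ (b + k) % n → a % n ≡ b % n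
%-cancelʳ-+ {a} {b} k n@(suc n-1) eq = begin
  a % n                              ≡⟨ unshift a ⟩
  (a + k + n-1 * k) % n              ≡⟨ %-distribˡ-+ (a + k) (n-1 * k) n ⟩
  ((a + k) % n + n-1 * k % n) % n    ≡⟨ cong (λ x → (x + n-1 * k % n) % n) eq ⟩
  ((b + k) % n + n-1 * k % n) % n    ≡⟨ %-distribˡ-+ (b + k) (n-1 * k) n ⟨
  (b + k + n-1 * k) % n              ≡⟨ unshift b ⟨
  b % n                              ∎
  where
  unshift : ∀ x → x % n ≡ (x + k + n-1 * k) % n
  unshift x = trans (sym ([m+kn]%n≡m%n x k n))
    (cong (_% n) (solve 3 (λ x k m → x :+ k :* (con 1 :+ m) := x :+ k :+ m :* k) refl x k n-1))

%-congʳ-+ : ∀ m n d .{{_ : NonZero d}} → (m + n % d) % d ≡ (m + n) % d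
%-congʳ-+ m n d = begin
  (m + n % d) % d          ≡⟨ %-distribˡ-+ m (n % d) d ⟩
  (m % d + n % d % d) % d  ≡⟨ cong (λ x → (m % d + x) % d) (m%n%n≡m%n n d) ⟩
  (m % d + n % d) % d      ≡⟨ %-distribˡ-+ m n d ⟨
  (m + n) % d              ∎

residue-mirror : ∀ n .{{_ : NonZero n}} {x y c c' m} → c' < n →
                 suc (x + y) ≡ m → suc (c + c') % n ≡ m % n → y % n ≡ c → x % n ≡ c'
residue-mirror n {x} {y} {c} {c'} {m} c'<n x+y≡ c+c'≡ y≡c = begin
  x % n   ≡⟨ %-cancelʳ-+ (suc c) n shifted ⟩
  c' % n  ≡⟨ m<n⇒m%n≡m c'<n ⟩
  c'      ∎
  where
  shifted : (x + suc c) % n ≡ (c' + suc c) % n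
  shifted = begin
    (x + suc c) % n        ≡⟨ cong (λ z → (x + suc z) % n) y≡c ⟨
    (x + suc (y % n)) % n  ≡⟨ cong (_% n) (+-suc x (y % n)) ⟩
    (suc x + y % n) % n    ≡⟨ %-congʳ-+ (suc x) y n ⟩
    suc (x + y) % n        ≡⟨ cong (_% n) x+y≡ ⟩
    m % n                  ≡⟨ c+c'≡ ⟨
    suc (c + c') % n       ≡⟨ cong (λ z → suc z % n) (+-comm c c') ⟩
    suc (c' + c) % n       ≡⟨ cong (_% n) (+-suc c' c) ⟨
    (c' + suc c) % n       ∎

δ-mirror : ∀ n .{{_ : NonZero n}} {x y c c' m} → c < n → c' < n →
           suc (x + y) ≡ m → suc (c + c') % n ≡ m % n → δ c (y % n) ≡ δ c' (x % n)
δ-mirror n {x} {y} {c} {c'} c<n c'<n x+y≡ c+c'≡ =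
  δ-cong (residue-mirror n c'<n x+y≡ c+c'≡) (residue-mirror n c<n y+x≡ c'+c≡)
  where
  y+x≡ = trans (cong suc (+-comm y x)) x+y≡
  c'+c≡ = trans (cong (λ z → suc z % n) (+-comm c' c)) c+c'≡

All-≤-largest : ∀ {Λ} → Linked _≥_ Λ → All (_≤ largest Λ) Λ
All-≤-largest {[]}    _      = []
All-≤-largest {x ∷ r} sorted = Linked⇒All (λ y≤x z≤y → ≤-trans z≤y y≤x) ≤-refl sorted

gapNum : List ℕ → ℕ → ℕ
gapNum Λ i = length Λ + i ∸ conjPart Λ (suc i)

conjPart-cons-< : ∀ {x i} r → i < x → conjPart (x ∷ r) (suc i) ≡ suc (conjPart r (suc i))
conjPart-cons-< {i = i} r i<x = cong length (filter-accept (suc i ≤?_) i<x)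

conjPart-≡0 : ∀ {i} Λ → All (_≤ i) Λ → conjPart Λ (suc i) ≡ 0
conjPart-≡0 {i} Λ parts≤i = cong length (filter-none (suc i ≤?_) (All.map ≤⇒≯ parts≤i))

structNum-head : ∀ x r → structNum (x ∷ r) 1 ≡ length r + x
structNum-head x r = trans (cong (_∸ 1) (+-suc x (length r))) (+-comm x (length r))

structNum-cons : ∀ x r j → structNum (x ∷ r) (suc (suc j)) ≡ structNum r (suc j)
structNum-cons x r j = cong (_∸ suc (suc j)) (+-suc (part r (suc j)) (length r))

gapNum-cons-< : ∀ {x i} r → i < x → gapNum (x ∷ r) i ≡ gapNum r i
gapNum-cons-< {i = i} r i<x = cong (suc (length r) + i ∸_) (conjPart-cons-< r i<x)

gapNum-cons-≥ : ∀ {x} r k → All (_≤ x) (x ∷ r) →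
                gapNum (x ∷ r) (x + k) ≡ length r + x + suc k
gapNum-cons-≥ {x} r k parts≤x = begin
  suc (length r) + (x + k) ∸ conjPart (x ∷ r) (suc (x + k))
    ≡⟨ cong (suc (length r) + (x + k) ∸_) (conjPart-≡0 (x ∷ r) parts≤x+k) ⟩
  suc (length r + (x + k))
    ≡⟨ cong suc (+-assoc (length r) x k) ⟨
  suc (length r + x + k)
    ≡⟨ +-suc (length r + x) k ⟨
  length r + x + suc k ∎
  where
  parts≤x+k = All.map (λ p → ≤-trans p (m≤m+n x k)) parts≤x

sumBelow-gapNum-cons : ∀ g {x n} r → x ≤ n → All (_≤ x) (x ∷ r) →
  sumBelow (g ∘ gapNum (x ∷ r)) n
    ≡ sumBelow (g ∘ gapNum r) x + sumBelow (λ k → g (length r + x + suc k)) (n ∸ x)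
sumBelow-gapNum-cons g {x} {n} r x≤n parts≤x = begin
  sumBelow (g ∘ gapNum (x ∷ r)) n
    ≡⟨ cong (sumBelow (g ∘ gapNum (x ∷ r))) (m+[n∸m]≡n x≤n) ⟨
  sumBelow (g ∘ gapNum (x ∷ r)) (x + (n ∸ x))
    ≡⟨ sumBelow-+ (g ∘ gapNum (x ∷ r)) x (n ∸ x) ⟩
  sumBelow (g ∘ gapNum (x ∷ r)) x + sumBelow (g ∘ gapNum (x ∷ r) ∘ (x +_)) (n ∸ x)
    ≡⟨ cong₂ _+_ (sumBelow-cong x (cong g ∘ gapNum-cons-< r))
                 (sumBelow-cong (n ∸ x) (λ {k} _ → cong g (gapNum-cons-≥ r k parts≤x))) ⟩
  sumBelow (g ∘ gapNum r) x + sumBelow (λ k → g (length r + x + suc k)) (n ∸ x) ∎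

sumBelow-structNum-gapNum : ∀ g {n} Λ → Linked _≥_ Λ → All (_≤ n) Λ →
  sumBelow (g ∘ structNum Λ ∘ suc) (length Λ) + sumBelow (g ∘ gapNum Λ) n
    ≡ sumBelow g (length Λ + n)
sumBelow-structNum-gapNum g     []      _      _         = refl
sumBelow-structNum-gapNum g {n} (x ∷ r) sorted (x≤n ∷ _) = begin
  g (structNum (x ∷ r) 1) + sumBelow (g ∘ structNum (x ∷ r) ∘ suc ∘ suc) m
    + sumBelow (g ∘ gapNum (x ∷ r)) n
    ≡⟨ cong₂ _+_ (cong₂ _+_ (cong g (structNum-head x r))
                            (sumBelow-cong m (λ {j} _ → cong g (structNum-cons x r j))))
                 (sumBelow-gapNum-cons g r x≤n parts≤x) ⟩
  g (m + x) + beads + (gaps + rest)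
    ≡⟨ solve 4 (λ a b c d → a :+ b :+ (c :+ d) := (b :+ c) :+ (a :+ d))
               refl (g (m + x)) beads gaps rest ⟩
  (beads + gaps) + (g (m + x) + rest)
    ≡⟨ cong₂ _+_ (sumBelow-structNum-gapNum g r (Linked.tail sorted) (All.tail parts≤x))
                 (cong (λ y → g y + rest) (sym (+-identityʳ (m + x)))) ⟩
  sumBelow g (m + x) + sumBelow (g ∘ (m + x +_)) (suc (n ∸ x))
    ≡⟨ sumBelow-+ g (m + x) (suc (n ∸ x)) ⟨
  sumBelow g (m + x + suc (n ∸ x))
    ≡⟨ cong (sumBelow g) length≡ ⟩
  sumBelow g (suc m + n) ∎
  where
  m = length r
  parts≤x : All (_≤ x) (x ∷ r)
  parts≤x = All-≤-largest sorted
  beads = sumBelow (g ∘ structNum r ∘ suc) m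
  gaps = sumBelow (g ∘ gapNum r) x
  rest = sumBelow (λ k → g (m + x + suc k)) (n ∸ x)
  length≡ : m + x + suc (n ∸ x) ≡ suc m + n
  length≡ = trans (+-suc (m + x) (n ∸ x))
                  (cong suc (trans (+-assoc m x (n ∸ x)) (cong (m +_) (m+[n∸m]≡n x≤n))))

part-applyUpTo : ∀ f {n j} → j < n → part (applyUpTo f n) (suc j) ≡ f j
part-applyUpTo f {suc n} {zero}  _         = refl
part-applyUpTo f {suc n} {suc j} (s<s j<n) = part-applyUpTo (f ∘ suc) j<n

All-part : ∀ {P : ℕ → Set} {Λ j} → All P Λ → j < length Λ → P (part Λ (suc j))
All-part {j = zero}  (px ∷ _)  _         = px
All-part {j = suc j} (_ ∷ pxs) (s<s j<s) = All-part pxs j<s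

conjugate≡applyUpTo : ∀ Λ → conjugate Λ ≡ applyUpTo (λ k → conjPart Λ (suc k)) (largest Λ)
conjugate≡applyUpTo Λ = map-upTo (λ k → conjPart Λ (suc k)) (largest Λ)

selfConjugate⇒largest≡length : ∀ {Λ} → IsSelfConjugate Λ → largest Λ ≡ length Λ
selfConjugate⇒largest≡length {Λ} selfConj = begin
  largest Λ
    ≡⟨ length-applyUpTo _ (largest Λ) ⟨
  length (applyUpTo (λ k → conjPart Λ (suc k)) (largest Λ))
    ≡⟨ cong length (conjugate≡applyUpTo Λ) ⟨
  length (conjugate Λ)
    ≡⟨ cong length selfConj ⟩
  length Λ ∎

selfConjugate⇒parts≤length : ∀ {Λ} → Linked _≥_ Λ → IsSelfConjugate Λ →
                             All (_≤ length Λ) Λ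
selfConjugate⇒parts≤length {Λ} sorted selfConj =
  subst (λ n → All (_≤ n) Λ) (selfConjugate⇒largest≡length selfConj) (All-≤-largest sorted)

selfConjugate⇒conjPart≡part : ∀ {Λ j} → IsSelfConjugate Λ → j < length Λ →
                              conjPart Λ (suc j) ≡ part Λ (suc j)
selfConjugate⇒conjPart≡part {Λ} {j} selfConj j<s = begin
  conjPart Λ (suc j)
    ≡⟨ part-applyUpTo _ (subst (j <_) (sym (selfConjugate⇒largest≡length selfConj)) j<s) ⟨
  part (applyUpTo (λ k → conjPart Λ (suc k)) (largest Λ)) (suc j)
    ≡⟨ cong (λ L → part L (suc j)) (trans (sym (conjugate≡applyUpTo Λ)) selfConj) ⟩
  part Λ (suc j) ∎

∸-mirror : ∀ {p s j} → p ≤ s → j < s → suc (p + s ∸ suc j + (s + j ∸ p)) ≡ s + s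
∸-mirror {p} {s} {j} p≤s j<s = begin
  suc (p + s ∸ suc j + (s + j ∸ p))
    ≡⟨ cong₂ (λ u v → suc (u + v)) (+-∸-assoc p j<s) (+-∸-comm j p≤s) ⟩
  suc (p + (s ∸ suc j) + (s ∸ p + j))
    ≡⟨ solve 4 (λ p a b j → con 1 :+ (p :+ a :+ (b :+ j)) := (p :+ b) :+ (a :+ (con 1 :+ j)))
               refl p (s ∸ suc j) (s ∸ p) j ⟩
  p + (s ∸ p) + (s ∸ suc j + suc j)
    ≡⟨ cong₂ _+_ (m+[n∸m]≡n p≤s) (m∸n+n≡m j<s) ⟩
  s + s ∎

structNum+gapNum : ∀ {Λ j} → Linked _≥_ Λ → IsSelfConjugate Λ → j < length Λ →
                   suc (structNum Λ (suc j) + gapNum Λ j) ≡ length Λ + length Λ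
structNum+gapNum {Λ} {j} sorted selfConj j<s = begin
  suc (structNum Λ (suc j) + gapNum Λ j)
    ≡⟨ cong (λ c → suc (structNum Λ (suc j) + (length Λ + j ∸ c)))
            (selfConjugate⇒conjPart≡part selfConj j<s) ⟩
  suc (part Λ (suc j) + length Λ ∸ suc j + (length Λ + j ∸ part Λ (suc j)))
    ≡⟨ ∸-mirror (All-part (selfConjugate⇒parts≤length sorted selfConj) j<s) j<s ⟩
  length Λ + length Λ ∎

abacus7≡sumBelow : ∀ Λ c →
                   abacus7 Λ c ≡ sumBelow (λ i → δ c (structNum Λ (suc i) % 7)) (length Λ)
abacus7≡sumBelow Λ c = trans (cong (length ∘ filter inClass) (map-upTo suc (length Λ)))
                             (length-filter-applyUpTo inClass suc (length Λ))
  where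
  inClass = λ j → structNum Λ j % 7 ≟ c

abacus7-mirror : ∀ {Λ c c'} → Linked _≥_ Λ → IsSelfConjugate Λ → c < 7 → c' < 7 →
                 suc (c + c') % 7 ≡ (length Λ + length Λ) % 7 →
                 abacus7 Λ c + abacus7 Λ c' ≡ countResidue 7 c (length Λ + length Λ)
abacus7-mirror {Λ} {c} {c'} sorted selfConj c<7 c'<7 c+c'≡ = begin
  abacus7 Λ c + abacus7 Λ c'
    ≡⟨ cong₂ _+_ (abacus7≡sumBelow Λ c) (abacus7≡sumBelow Λ c') ⟩
  beadsIn c + beadsIn c'
    ≡⟨ cong (beadsIn c +_) (sumBelow-cong s (λ {j} j<s →
         δ-mirror 7 {structNum Λ (suc j)} {gapNum Λ j} c<7 c'<7
                  (structNum+gapNum sorted selfConj j<s) c+c'≡)) ⟨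
  beadsIn c + sumBelow (λ i → δ c (gapNum Λ i % 7)) s
    ≡⟨ sumBelow-structNum-gapNum (δ c ∘ (_% 7)) Λ sorted
                                 (selfConjugate⇒parts≤length sorted selfConj) ⟩
  countResidue 7 c (s + s) ∎
  where
  s = length Λ
  beadsIn = λ c → sumBelow (λ i → δ c (structNum Λ (suc i) % 7)) s

abacus7-mirror-7r+q : ∀ {Λ c c' r q} → Linked _≥_ Λ → IsSelfConjugate Λ →
                      length Λ ≡ 7 * r + q → c < 7 → c' < 7 →
                      suc (c + c') % 7 ≡ (q + q) % 7 →
                      abacus7 Λ c + abacus7 Λ c' ≡ 2 * r + countResidue 7 c (q + q)
abacus7-mirror-7r+q {Λ} {c} {c'} {r} {q} sorted selfConj s≡ c<7 c'<7 c+c'≡ = begin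
  abacus7 Λ c + abacus7 Λ c'
    ≡⟨ abacus7-mirror sorted selfConj c<7 c'<7 (trans c+c'≡ (sym s+s%7≡)) ⟩
  countResidue 7 c (length Λ + length Λ)
    ≡⟨ cong (countResidue 7 c) s+s≡ ⟩
  countResidue 7 c (2 * r * 7 + (q + q))
    ≡⟨ countResidue-+* 7 c<7 (2 * r) (q + q) ⟩
  2 * r + countResidue 7 c (q + q) ∎
  where
  s+s≡ : length Λ + length Λ ≡ 2 * r * 7 + (q + q)
  s+s≡ = trans (cong₂ _+_ s≡ s≡)
    (solve 2 (λ r q → (con 7 :* r :+ q) :+ (con 7 :* r :+ q) := con 2 :* r :* con 7 :+ (q :+ q))
             refl r q)
  s+s%7≡ : (length Λ + length Λ) % 7 ≡ (q + q) % 7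
  s+s%7≡ = trans (cong (_% 7) s+s≡) (%-remove-+ˡ (q + q) (n∣m*n (2 * r)))

m+m≡2*n⇒m≡n : ∀ {m n} → m + m ≡ 2 * n → m ≡ n
m+m≡2*n⇒m≡n {m} {n} m+m≡ = *-cancelˡ-≡ m n 2 (trans (cong (m +_) (+-identityʳ m)) m+m≡)

mainTheorem9 : (Λ : List ℕ) → IsPartition Λ → IsSelfConjugate Λ → IsCore 7 Λ →
    (a b c d e f : ℕ) →
    abacus7 Λ 0 ≡ 0 → abacus7 Λ 1 ≡ a → abacus7 Λ 2 ≡ b → abacus7 Λ 3 ≡ c →
    abacus7 Λ 4 ≡ d → abacus7 Λ 5 ≡ e → abacus7 Λ 6 ≡ f →
    length Λ % 7 ≢ 4 → (r : ℕ) →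
    (length Λ ≡ 7 * r → f ≡ 2 * r × a + e ≡ 2 * r × b + d ≡ 2 * r × c ≡ r)
    × (length Λ ≡ 7 * r + 1 → a ≡ 2 * r + 1 × b + f ≡ 2 * r × c + e ≡ 2 * r × d ≡ r)
    × (length Λ ≡ 7 * r + 2 → a + b ≡ 2 * r + 1 × c ≡ 2 * r + 1 × d + f ≡ 2 * r × e ≡ r)
    × (length Λ ≡ 7 * r + 3 → b + c ≡ 2 * r + 1 × a + d ≡ 2 * r + 1 × e ≡ 2 * r + 1 × f ≡ r)
    × (length Λ ≡ 7 * r + 5 → d + e ≡ 2 * r + 1 × c + f ≡ 2 * r + 1 × b ≡ 2 * r + 2 × a ≡ r + 1)
    × (length Λ ≡ 7 * r + 6 → e + f ≡ 2 * r + 1 × d ≡ 2 * r + 2 × a + c ≡ 2 * r + 2 × b ≡ r + 1)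
mainTheorem9 Λ (sorted , _) selfConj _ a b c d e f m₀≡0 refl refl refl refl refl refl _ r =
    (λ s≡ → let s≡′ = trans s≡ (sym (+-identityʳ (7 * r))) in
        noRemainder (drop-column0 (pair s≡′ 0 6 refl)) , noRemainder (pair s≡′ 1 5 refl)
      , noRemainder (pair s≡′ 2 4 refl) , m+m≡2*n⇒m≡n (noRemainder (pair s≡′ 3 3 refl)))
  , (λ s≡ → drop-column0 (pair s≡ 0 1 refl) , noRemainder (pair s≡ 2 6 refl)
      , noRemainder (pair s≡ 3 5 refl) , m+m≡2*n⇒m≡n (noRemainder (pair s≡ 4 4 refl)))
  , (λ s≡ → pair s≡ 1 2 refl , drop-column0 (pair s≡ 0 3 refl)
      , noRemainder (pair s≡ 4 6 refl) , m+m≡2*n⇒m≡n (noRemainder (pair s≡ 5 5 refl)))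
  , (λ s≡ → pair s≡ 2 3 refl , pair s≡ 1 4 refl
      , drop-column0 (pair s≡ 0 5 refl) , m+m≡2*n⇒m≡n (noRemainder (pair s≡ 6 6 refl)))
  , (λ s≡ → pair s≡ 4 5 refl , pair s≡ 3 6 refl
      , drop-column0 (pair s≡ 0 2 refl) , m+m≡2*n⇒m≡n (trans (pair s≡ 1 1 refl) 2r+2≡2[r+1]))
  , (λ s≡ → pair s≡ 5 6 refl , drop-column0 (pair s≡ 0 4 refl)
      , pair s≡ 1 3 refl , m+m≡2*n⇒m≡n (trans (pair s≡ 2 2 refl) 2r+2≡2[r+1]))
  where
  -- For literal i and q, countResidue 7 i (q + q) normalises to the expected constant.
  pair : ∀ {q} → length Λ ≡ 7 * r + q → ∀ i j {_ : T (i <ᵇ 7)} {_ : T (j <ᵇ 7)} →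
         suc (i + j) % 7 ≡ (q + q) % 7 →
         abacus7 Λ i + abacus7 Λ j ≡ 2 * r + countResidue 7 i (q + q)
  pair {q} s≡ i j {i<7} {j<7} =
    abacus7-mirror-7r+q {r = r} {q = q} sorted selfConj s≡ (<ᵇ⇒< i 7 i<7) (<ᵇ⇒< j 7 j<7)
  drop-column0 : ∀ {x y} → abacus7 Λ 0 + x ≡ y → x ≡ y
  drop-column0 {x} = trans (cong (_+ x) (sym m₀≡0))
  noRemainder : ∀ {x} → x ≡ 2 * r + 0 → x ≡ 2 * r
  noRemainder x≡ = trans x≡ (+-identityʳ (2 * r))
  2r+2≡2[r+1] : 2 * r + 2 ≡ 2 * (r + 1)
  2r+2≡2[r+1] = sym (*-distribˡ-+ 2 r 1)
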